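{- Let $q$ be a power of an odd prime, $c\in\mathbb{F}_q^*$, and $f:\mathbb{F}_{q^2}\to\mathbb{F}_{q^2}$, $f(X)=c(X^{q+1}-X^2)$. Every cycle of $f$ of length greater than $1$ has even length; that is, if $\alpha\in\mathbb{F}_{q^2}$ satisfies $f^{(n)}(\alpha)=\alpha$ with $n\ge1$ minimal and $n>1$, then $n$ is even.
   Context: $f^{(0)}(x)=x$ and $f^{(n+1)}(x)=f(f^{(n)}(x))$. A cycle of length $n$ is the orbit $\{\alpha,f(\alpha),\dots,f^{(n-1)}(\alpha)\}$ of a point $\alpha$ with $f^{(n)}(\alpha)=\alpha$ and $n\ge1$ minimal. -}

module Defs where

open import Level using (_⊔_)
open import Data.Nat using (ℕ; zero; suc; _≤_; _<_)
open import Data.Nat.Primality using (Prime)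
open import Data.Fin using (Fin)
open import Data.Product using (Σ; ∃; _×_)
open import Relation.Nullary using (¬_)
open import Relation.Binary.PropositionalEquality as ≡ using (_≡_)
open import Function.Bundles using (Inverse)
open import Algebra.Bundles using (CommutativeRing)

OddPrimePower : ℕ → Set
OddPrimePower q = Σ ℕ λ p → Σ ℕ λ k → Prime p × ¬ (p ≡ 2) × 1 ≤ k × q ≡ p Data.Nat.^ k

iter : ∀ {a} {A : Set a} → (A → A) → ℕ → A → A
iter f zero x = x
iter f (suc n) x = f (iter f n x)

module _ {c ℓ} (R : CommutativeRing c ℓ) where
  open CommutativeRing R

  pow : Carrier → ℕ → Carrier
  pow x zero = 1#
  pow x (suc n) = x * pow x n

  record IsField : Set (c ⊔ ℓ) where
    field
      1≉0 : ¬ (1# ≈ 0#)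
      inverse : ∀ x → ¬ (x ≈ 0#) → ∃ λ y → x * y ≈ 1#

  HasCard : ℕ → Set (c ⊔ ℓ)
  HasCard n = Inverse (≡.setoid (Fin n)) setoid

  IsCycleLength : (Carrier → Carrier) → Carrier → ℕ → Set ℓ
  IsCycleLength f α n =
    1 ≤ n × iter f n α ≈ α × (∀ m → 1 ≤ m → m < n → ¬ (iter f m α ≈ α))

module Submission where

-- Write x̄ = x ^ q. In the field with q² elements, x ↦ x̄ is a ring involution (Frobenius additivity
-- plus Lagrange's theorem for the additive and multiplicative groups), and c̄ = c. Now
-- f x = s x with s = c (x̄ − x) and s̄ = −s, so f x · x̄ = −x · (f x)‾: for x ≠ 0 the ratio x / x̄
-- changes sign under f. A point α on a cycle of length n > 1 and its whole orbit are nonzero,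
-- because 0 is a fixed point. Going once around the cycle multiplies α / ᾱ by (−1)ⁿ, and for odd n
-- this gives 2 α ᾱ = 0, impossible in odd characteristic.

open import Level using (_⊔_)
open import Data.Nat as ℕ using (ℕ; zero; suc; _<_; _≤_; z≤n; s≤s)
import Data.Nat.Properties as ℕ
open import Data.Nat.Divisibility using (_∣_; divides; _∣0; >⇒∤)
open import Data.Nat.Primality using (Prime; ¬prime[0]; euclidsLemma; prime⇒irreducible)
open import Data.Nat.Combinatorics using (_C_; nCn≡1; nC1≡n; nCk+nC[k+1]≡[n+1]C[k+1])
open import Data.Nat.Combinatorics.Specification using (k>n⇒nCk≡0)
open import Data.Nat.Solver using (module +-*-Solver)
open import Data.Fin as Fin using (Fin; fromℕ; inject₁; punchIn)
open import Data.Fin.Properties using (toℕ-fromℕ; inject₁ℕ<; punchInᵢ≢i)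
open import Data.Fin.Permutation using (Permutation; _⟨$⟩ʳ_; remove; punchIn-permute)
open import Data.Product as Product using (∃; _,_; proj₂; map₁)
open import Data.Sum using (_⊎_; inj₁; inj₂)
open import Function.Bundles using (Inverse)
import Function.Construct.Composition as Composition
import Function.Construct.Symmetry as Symmetry
open import Algebra.Bundles using (CommutativeMonoid; CommutativeSemiring; CommutativeRing)
open import Relation.Nullary using (¬_; yes; no; contradiction)
open import Relation.Nullary.Decidable using (map′; decidable-stable)
open import Relation.Binary.Definitions using (Decidable)
open import Relation.Binary.PropositionalEquality as ≡ using (_≡_)

open import Defs

even-or-odd : ∀ n → 2 ∣ n ⊎ ∃ λ m → n ≡ suc (m ℕ.* 2)
even-or-odd zero = inj₁ (2 ∣0)
even-or-odd (suc n) with even-or-odd n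
... | inj₁ (divides m ≡.refl) = inj₂ (m , ≡.refl)
... | inj₂ (m , ≡.refl)       = inj₁ (divides (suc m) ≡.refl)

prime≢2⇒odd : ∀ {p} → Prime p → ¬ p ≡ 2 → ∃ λ m → p ≡ suc (m ℕ.* 2)
prime≢2⇒odd {p} p-prime p≢2 with even-or-odd p
... | inj₂ odd = odd
... | inj₁ 2∣p with prime⇒irreducible p-prime 2∣p
...   | inj₁ ()
...   | inj₂ 2≡p = contradiction (≡.sym 2≡p) p≢2

[k+1]*[n+1]C[k+1]≡[n+1]*nCk : ∀ n k → suc k ℕ.* (suc n C suc k) ≡ suc n ℕ.* (n C k)
[k+1]*[n+1]C[k+1]≡[n+1]*nCk zero zero = ≡.refl
[k+1]*[n+1]C[k+1]≡[n+1]*nCk zero (suc k)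
  rewrite k>n⇒nCk≡0 {1} {2 ℕ.+ k} (s≤s (s≤s z≤n)) | k>n⇒nCk≡0 {0} {suc k} (s≤s z≤n) = ℕ.*-comm (2 ℕ.+ k) 0
[k+1]*[n+1]C[k+1]≡[n+1]*nCk (suc n) zero rewrite nC1≡n (2 ℕ.+ n) = ≡.cong suc (ℕ.*-comm 1 (suc n))
[k+1]*[n+1]C[k+1]≡[n+1]*nCk (suc n) (suc k) = begin
    (2 + k) * ((2 + n) C (2 + k))
  ≡⟨ ≡.cong ((2 + k) *_) (≡.sym (nCk+nC[k+1]≡[n+1]C[k+1] (suc n) (suc k))) ⟩
    (2 + k) * (A + B)
  ≡⟨ solve 3 (λ k A B → (con 2 :+ k) :* (A :+ B) := A :+ (con 1 :+ k) :* A :+ (con 2 :+ k) :* B) ≡.refl k A B ⟩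
    A + (1 + k) * A + (2 + k) * B
  ≡⟨ ≡.cong₂ (λ u v → A + u + v) ([k+1]*[n+1]C[k+1]≡[n+1]*nCk n k) ([k+1]*[n+1]C[k+1]≡[n+1]*nCk n (suc k)) ⟩
    A + (1 + n) * (n C k) + (1 + n) * (n C suc k)
  ≡⟨ solve 4 (λ n A X Y → A :+ (con 1 :+ n) :* X :+ (con 1 :+ n) :* Y := A :+ (con 1 :+ n) :* (X :+ Y)) ≡.refl n A (n C k) (n C suc k) ⟩
    A + (1 + n) * (n C k + n C suc k)
  ≡⟨ ≡.cong (λ s → A + (1 + n) * s) (nCk+nC[k+1]≡[n+1]C[k+1] n k) ⟩
    A + (1 + n) * A
  ∎
  where
  open ≡.≡-Reasoning
  open +-*-Solver
  open import Data.Nat using (_+_; _*_)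
  A B : ℕ
  A = suc n C suc k
  B = suc n C suc (suc k)

p∣pCk : ∀ {p k} → Prime p → 0 < k → k < p → p ∣ p C k
p∣pCk {suc n} {suc k} p-prime _ k<p with euclidsLemma (suc k) (suc n C suc k) p-prime
  (divides (n C k) (≡.trans ([k+1]*[n+1]C[k+1]≡[n+1]*nCk n k) (ℕ.*-comm (suc n) (n C k))))
... | inj₁ p∣k = contradiction p∣k (>⇒∤ k<p)
... | inj₂ p∣C = p∣C

iter-+ : ∀ {a} {A : Set a} (f : A → A) m n x → iter f (m ℕ.+ n) x ≡ iter f m (iter f n x)
iter-+ f zero    n x = ≡.refl
iter-+ f (suc m) n x = ≡.cong f (iter-+ f m n x)

module _ {a ℓ} (F : CommutativeRing a ℓ) where
  open CommutativeRing F

  iter-odd : ∀ {g} → (∀ x → g (g x) ≈ x) → ∀ m x → iter g (suc (m ℕ.* 2)) x ≈ g x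
  iter-odd g-involutive zero    x = refl
  iter-odd {g} g-involutive (suc m) x = trans (g-involutive (iter g (suc (m ℕ.* 2)) x)) (iter-odd {g} g-involutive m x)

  module _ {f : Carrier → Carrier} (f-cong : ∀ {x y} → x ≈ y → f x ≈ f y) where

    iter-cong : ∀ m {x y} → x ≈ y → iter f m x ≈ iter f m y
    iter-cong zero    x≈y = x≈y
    iter-cong (suc m) x≈y = f-cong (iter-cong m x≈y)

    iter-fixed : ∀ {z} → f z ≈ z → ∀ m → iter f m z ≈ z
    iter-fixed fz≈z zero    = refl
    iter-fixed fz≈z (suc m) = trans (f-cong (iter-fixed fz≈z m)) fz≈z

    cycle-avoids-fixed-point : ∀ {α n z} → IsCycleLength F f α n → 1 < n → f z ≈ z →
                               ∀ {j} → j ≤ n → ¬ iter f j α ≈ z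
    cycle-avoids-fixed-point {α} {n} {z} (_ , fⁿα≈α , minimal) 1<n fz≈z {j} j≤n fʲα≈z =
      minimal 1 ℕ.≤-refl 1<n (trans (f-cong α≈z) (trans fz≈z (sym α≈z)))
      where
      α≈z : α ≈ z
      α≈z = begin
        α                               ≈⟨ fⁿα≈α ⟨
        iter f n α                      ≡⟨ ≡.cong (λ i → iter f i α) (ℕ.m∸n+n≡m j≤n) ⟨
        iter f (n ℕ.∸ j ℕ.+ j) α        ≡⟨ iter-+ f (n ℕ.∸ j) j α ⟩
        iter f (n ℕ.∸ j) (iter f j α)   ≈⟨ iter-cong (n ℕ.∸ j) fʲα≈z ⟩
        iter f (n ℕ.∸ j) z              ≈⟨ iter-fixed fz≈z (n ℕ.∸ j) ⟩
        z                               ∎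
        where open import Relation.Binary.Reasoning.Setoid setoid

module _ {a ℓ} (M : CommutativeMonoid a ℓ) where
  open CommutativeMonoid M
  open import Algebra.Properties.CommutativeMonoid.Sum M using (sum; ∑-distrib-+; sum-replicate; sum-cong-≋; sum-permute)
  open import Algebra.Properties.Monoid.Mult monoid using (_×_)
  open import Relation.Binary.Reasoning.Setoid setoid

  translation : ∀ {x y} → x ∙ y ≈ ε → Inverse setoid setoid
  translation {x} {y} x∙y≈ε = record
    { to        = x ∙_
    ; from      = y ∙_
    ; to-cong   = ∙-congˡ
    ; from-cong = ∙-congˡ
    ; inverse   = (λ w≈y∙z → trans (∙-congˡ w≈y∙z) (cancel x∙y≈ε _))
                , (λ w≈x∙z → trans (∙-congˡ w≈x∙z) (cancel (trans (comm y x) x∙y≈ε) _))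
    }
    where
    cancel : ∀ {u v} → u ∙ v ≈ ε → ∀ z → u ∙ (v ∙ z) ≈ z
    cancel {u} {v} u∙v≈ε z = trans (sym (assoc u v z)) (trans (∙-congʳ u∙v≈ε) (identityˡ z))

  sum-translate : ∀ {n} (w : Fin n → Carrier) (π : Permutation n n) x →
                  (∀ i → x ∙ w i ≈ w (π ⟨$⟩ʳ i)) → n × x ∙ sum w ≈ sum w
  sum-translate {n} w π x x∙w≈w∘π = begin
    n × x ∙ sum w             ≈⟨ ∙-congʳ (sum-replicate n) ⟨
    sum {n} (λ _ → x) ∙ sum w ≈⟨ ∑-distrib-+ (λ _ → x) w ⟨
    sum (λ i → x ∙ w i)       ≈⟨ sum-cong-≋ x∙w≈w∘π ⟩
    sum (λ i → w (π ⟨$⟩ʳ i))  ≈⟨ sum-permute w π ⟨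
    sum w                     ∎

-- Characteristic p and the Frobenius map

module _ {a ℓ} (S : CommutativeSemiring a ℓ) where
  open CommutativeSemiring S hiding (zero)
  open import Algebra.Properties.Semiring.Mult semiring using (_×_; ×-assoc-*; ×1-homo-*; ×-congʳ)
  open import Algebra.Properties.Semiring.Sum semiring using (sum; sum-init-last; sum-cong-≋; sum-replicate-zero)
  open import Algebra.Properties.CommutativeSemiring.Exp S using (_^_; ^-assocʳ; ^-congˡ)
  open import Algebra.Properties.CommutativeSemiring.Binomial S using (theorem; binomialTerm)
  open import Relation.Binary.Reasoning.Setoid setoid

  ×1-homo-^ : ∀ n j → (n ℕ.^ j) × 1# ≈ (n × 1#) ^ j
  ×1-homo-^ n zero    = +-identityʳ 1#
  ×1-homo-^ n (suc j) = trans (×1-homo-* n (n ℕ.^ j)) (*-congˡ (×1-homo-^ n j))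

  ×-multiple≈0 : ∀ {p n} → p × 1# ≈ 0# → p ∣ n → ∀ x → n × x ≈ 0#
  ×-multiple≈0 {p} p×1≈0 (divides m ≡.refl) x = begin
    (m ℕ.* p) × x               ≈⟨ ×-congʳ (m ℕ.* p) (*-identityˡ x) ⟨
    (m ℕ.* p) × (1# * x)        ≈⟨ ×-assoc-* (m ℕ.* p) 1# x ⟨
    ((m ℕ.* p) × 1#) * x        ≈⟨ *-congʳ (×1-homo-* m p) ⟩
    ((m × 1#) * (p × 1#)) * x   ≈⟨ *-congʳ (*-congˡ p×1≈0) ⟩
    ((m × 1#) * 0#) * x         ≈⟨ *-congʳ (zeroʳ _) ⟩
    0# * x                      ≈⟨ zeroˡ x ⟩
    0#                          ∎

  odd×1≈1 : 1# + 1# ≈ 0# → ∀ m → suc (m ℕ.* 2) × 1# ≈ 1#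
  odd×1≈1 1+1≈0 m = begin
    1# + (m ℕ.* 2) × 1#   ≈⟨ +-congˡ (×-multiple≈0 2×1≈0 (divides m ≡.refl) 1#) ⟩
    1# + 0#               ≈⟨ +-identityʳ 1# ⟩
    1#                    ∎
    where
    2×1≈0 : 2 × 1# ≈ 0#
    2×1≈0 = trans (+-congˡ (+-identityʳ 1#)) 1+1≈0

  frobenius : ∀ {p} → Prime p → p × 1# ≈ 0# → ∀ x y → (x + y) ^ p ≈ x ^ p + y ^ p
  frobenius {zero} p-prime = contradiction p-prime ¬prime[0]
  frobenius {suc m} p-prime p×1≈0 x y = begin
    (x + y) ^ suc m
      ≈⟨ theorem (suc m) x y ⟩
    t Fin.zero + sum (λ i → t (Fin.suc i))
      ≈⟨ +-cong (+-identityʳ _) (sum-init-last (λ i → t (Fin.suc i))) ⟩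
    1# * y ^ suc m + (sum inner + t (Fin.suc (fromℕ m)))
      ≈⟨ +-cong (*-identityˡ _) (+-cong (sum-cong-≋ {m} inner≈0) (top (toℕ-fromℕ m))) ⟩
    y ^ suc m + (sum {m} (λ _ → 0#) + x ^ suc m)
      ≈⟨ +-congˡ (trans (+-congʳ (sum-replicate-zero m)) (+-identityˡ _)) ⟩
    y ^ suc m + x ^ suc m
      ≈⟨ +-comm _ _ ⟩
    x ^ suc m + y ^ suc m
      ∎
    where
    t : Fin (suc (suc m)) → Carrier
    t = binomialTerm x y (suc m)
    inner : Fin m → Carrier
    inner i = t (Fin.suc (inject₁ i))
    inner≈0 : ∀ i → inner i ≈ 0#
    inner≈0 i = ×-multiple≈0 p×1≈0 (p∣pCk p-prime (s≤s z≤n) (s≤s (inject₁ℕ< i))) _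
    top : ∀ {k} → k ≡ m → (suc m C suc k) × (x ^ suc k * y ^ (m ℕ.∸ k)) ≈ x ^ suc m
    top ≡.refl = begin
      (suc m C suc m) × (x ^ suc m * y ^ (m ℕ.∸ m))  ≡⟨ ≡.cong₂ (λ c e → c × (x ^ suc m * y ^ e)) (nCn≡1 (suc m)) (ℕ.n∸n≡0 m) ⟩
      1 × (x ^ suc m * 1#)                          ≈⟨ +-identityʳ _ ⟩
      x ^ suc m * 1#                                ≈⟨ *-identityʳ _ ⟩
      x ^ suc m                                     ∎

  frobenius-^ : ∀ {p} → Prime p → p × 1# ≈ 0# → ∀ j x y → (x + y) ^ (p ℕ.^ j) ≈ x ^ (p ℕ.^ j) + y ^ (p ℕ.^ j)
  frobenius-^ p-prime p×1≈0 zero x y = trans (*-identityʳ _) (sym (+-cong (*-identityʳ x) (*-identityʳ y)))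
  frobenius-^ {p} p-prime p×1≈0 (suc j) x y = begin
    (x + y) ^ (p ℕ.* q)             ≈⟨ ^-assocʳ (x + y) p q ⟨
    ((x + y) ^ p) ^ q               ≈⟨ ^-congˡ q (frobenius p-prime p×1≈0 x y) ⟩
    (x ^ p + y ^ p) ^ q             ≈⟨ frobenius-^ p-prime p×1≈0 j (x ^ p) (y ^ p) ⟩
    (x ^ p) ^ q + (y ^ p) ^ q       ≈⟨ +-cong (^-assocʳ x p q) (^-assocʳ y p q) ⟩
    x ^ (p ℕ.* q) + y ^ (p ℕ.* q)   ∎
    where
    q : ℕ
    q = p ℕ.^ j

module FieldProperties {a ℓ} (F : CommutativeRing a ℓ) (isField : IsField F) where
  open CommutativeRing F
  open IsField isField
  open import Algebra.Properties.CommutativeSemiring.Exp commutativeSemiring using (_^_)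
  open import Algebra.Properties.Ring ring using (-‿distribˡ-*)
  open import Algebra.Properties.Monoid.Sum *-monoid using () renaming (sum to product)
  open import Algebra.Solver.CommutativeMonoid *-commutativeMonoid using (solve; _⊕_; _⊜_)
  open import Relation.Binary.Reasoning.Setoid setoid

  *-cancelˡ : ∀ {x y z} → ¬ x ≈ 0# → x * y ≈ x * z → y ≈ z
  *-cancelˡ {x} {y} {z} x≉0 xy≈xz with inverse x x≉0
  ... | x⁻¹ , xx⁻¹≈1 = begin
    y                 ≈⟨ *-identityˡ y ⟨
    1# * y            ≈⟨ *-congʳ xx⁻¹≈1 ⟨
    (x * x⁻¹) * y     ≈⟨ solve 3 (λ x x⁻¹ y → (x ⊕ x⁻¹) ⊕ y ⊜ x⁻¹ ⊕ (x ⊕ y)) refl x x⁻¹ y ⟩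
    x⁻¹ * (x * y)     ≈⟨ *-congˡ xy≈xz ⟩
    x⁻¹ * (x * z)     ≈⟨ solve 3 (λ x x⁻¹ z → x⁻¹ ⊕ (x ⊕ z) ⊜ (x ⊕ x⁻¹) ⊕ z) refl x x⁻¹ z ⟩
    (x * x⁻¹) * z     ≈⟨ *-congʳ xx⁻¹≈1 ⟩
    1# * z            ≈⟨ *-identityˡ z ⟩
    z                 ∎

  *-nonzero : ∀ {x y} → ¬ x ≈ 0# → ¬ y ≈ 0# → ¬ x * y ≈ 0#
  *-nonzero {x} x≉0 y≉0 xy≈0 = y≉0 (*-cancelˡ x≉0 (trans xy≈0 (sym (zeroʳ x))))

  ^-nonzero : ∀ {x} → ¬ x ≈ 0# → ∀ n → ¬ x ^ n ≈ 0#
  ^-nonzero x≉0 zero    = 1≉0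
  ^-nonzero x≉0 (suc n) = *-nonzero x≉0 (^-nonzero x≉0 n)

  x+x≈0⇒x≈0 : ¬ 1# + 1# ≈ 0# → ∀ {x} → x + x ≈ 0# → x ≈ 0#
  x+x≈0⇒x≈0 2≉0 {x} x+x≈0 = *-cancelˡ 2≉0 (begin
    (1# + 1#) * x     ≈⟨ distribʳ x 1# 1# ⟩
    1# * x + 1# * x   ≈⟨ +-cong (*-identityˡ x) (*-identityˡ x) ⟩
    x + x             ≈⟨ x+x≈0 ⟩
    0#                ≈⟨ zeroʳ _ ⟨
    (1# + 1#) * 0#    ∎)

  -- A pair (x , x′) stands for the fraction x / x′, compared by cross-multiplication.
  infix 4 _∼_
  _∼_ : Carrier Product.× Carrier → Carrier Product.× Carrier → Set ℓ
  (x , x′) ∼ (y , y′) = x * y′ ≈ y * x′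

  ∼-trans : ∀ {u v w} → ¬ proj₂ v ≈ 0# → u ∼ v → v ∼ w → u ∼ w
  ∼-trans {x , x′} {y , y′} {z , z′} y′≉0 u∼v v∼w = *-cancelˡ y′≉0 (begin
    y′ * (x * z′)   ≈⟨ solve 3 (λ x y′ z′ → y′ ⊕ (x ⊕ z′) ⊜ (x ⊕ y′) ⊕ z′) refl x y′ z′ ⟩
    (x * y′) * z′   ≈⟨ *-congʳ u∼v ⟩
    (y * x′) * z′   ≈⟨ solve 3 (λ y x′ z′ → (y ⊕ x′) ⊕ z′ ⊜ (y ⊕ z′) ⊕ x′) refl y x′ z′ ⟩
    (y * z′) * x′   ≈⟨ *-congʳ v∼w ⟩
    (z * y′) * x′   ≈⟨ solve 3 (λ z y′ x′ → (z ⊕ y′) ⊕ x′ ⊜ y′ ⊕ (z ⊕ x′)) refl z y′ x′ ⟩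
    y′ * (z * x′)   ∎)

  ∼-negate : ∀ {u v} → u ∼ v → map₁ -_ u ∼ map₁ -_ v
  ∼-negate {x , x′} {y , y′} u∼v = begin
    - x * y′     ≈⟨ -‿distribˡ-* x y′ ⟨
    - (x * y′)   ≈⟨ -‿cong u∼v ⟩
    - (y * x′)   ≈⟨ -‿distribˡ-* y x′ ⟩
    - y * x′     ∎

  product-nonzero : ∀ {n} (w : Fin n → Carrier) → (∀ i → ¬ w i ≈ 0#) → ¬ product w ≈ 0#
  product-nonzero {zero}  w w≉0 = 1≉0
  product-nonzero {suc n} w w≉0 = *-nonzero (w≉0 Fin.zero) (product-nonzero (λ i → w (Fin.suc i)) (λ i → w≉0 (Fin.suc i)))

-- Lagrange's theorem in finite fields

module FiniteField {a ℓ} (F : CommutativeRing a ℓ) (isField : IsField F) {N} (card : HasCard F N) where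
  open CommutativeRing F
  open FieldProperties F isField
  open Inverse card using (from-cong; strictlyInverseˡ) renaming (to to element; from to index)
  open import Algebra.Properties.Semiring.Mult semiring using (_×_)
  open import Algebra.Properties.CommutativeSemiring.Exp commutativeSemiring using (_^_)
  open import Algebra.Properties.Monoid.Sum +-monoid using (sum)
  open import Algebra.Properties.Group +-group using (loop)
  open import Algebra.Properties.Loop loop using (identityˡ-unique)
  open import Relation.Binary.Reasoning.Setoid setoid

  ≈-dec : Decidable _≈_
  ≈-dec x y = map′ index≡⇒≈ from-cong (index x Fin.≟ index y)
    where
    index≡⇒≈ : index x ≡ index y → x ≈ y
    index≡⇒≈ eq = begin
      x                  ≈⟨ strictlyInverseˡ x ⟨
      element (index x)  ≡⟨ ≡.cong element eq ⟩
      element (index y)  ≈⟨ strictlyInverseˡ y ⟩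
      y                  ∎

  ^≈0⇒≈0 : ∀ {x} n → x ^ n ≈ 0# → x ≈ 0#
  ^≈0⇒≈0 {x} n xⁿ≈0 = decidable-stable (≈-dec x 0#) (λ x≉0 → ^-nonzero x≉0 n xⁿ≈0)

  reindex : Inverse setoid setoid → Permutation N N
  reindex σ = Composition.inverse card (Composition.inverse σ (Symmetry.inverse card))

  card×x≈0 : ∀ x → N × x ≈ 0#
  card×x≈0 x = identityˡ-unique (N × x) (sum element)
    (sum-translate +-commutativeMonoid element (reindex (translation +-commutativeMonoid (-‿inverseʳ x))) x
      (λ i → sym (strictlyInverseˡ (x + element i))))

module _ {a ℓ} (F : CommutativeRing a ℓ) (isField : IsField F) where
  open CommutativeRing F
  open IsField isField
  open FieldProperties F isField
  open import Algebra.Properties.CommutativeSemiring.Exp commutativeSemiring using (_^_)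
  open import Algebra.Properties.Monoid.Sum *-monoid using () renaming (sum to product)
  open import Relation.Binary.Reasoning.Setoid setoid

  x^card≈x : ∀ {N} → HasCard F N → ∀ x → x ^ N ≈ x
  x^card≈x {zero} card x with Inverse.from card 0#
  ... | ()
  x^card≈x {suc m} card x with FiniteField.≈-dec F isField card x 0#
  ... | yes x≈0 = trans (*-congʳ x≈0) (trans (zeroˡ _) (sym x≈0))
  ... | no x≉0 with inverse x x≉0
  ...   | x⁻¹ , xx⁻¹≈1 = trans (*-congˡ xᵐ≈1) (*-identityʳ x)
    where
    open FiniteField F isField card using (reindex)
    open Inverse card using (from-cong; strictlyInverseˡ; strictlyInverseʳ) renaming (to to element; from to index)
    -- Multiplication by x permutes the nonzero elements, indexed by Fin m via punching out the index of 0.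
    z : Fin (suc m)
    z = index 0#
    π : Permutation (suc m) (suc m)
    π = reindex (translation *-commutativeMonoid xx⁻¹≈1)
    π-fixes-z : π ⟨$⟩ʳ z ≡ z
    π-fixes-z = from-cong (trans (*-congˡ (strictlyInverseˡ 0#)) (zeroʳ x))
    w : Fin m → Carrier
    w j = element (punchIn z j)
    w≉0 : ∀ j → ¬ w j ≈ 0#
    w≉0 j wj≈0 = punchInᵢ≢i z j (≡.trans (≡.sym (strictlyInverseʳ _)) (from-cong wj≈0))
    x*w≈w∘π : ∀ j → x * w j ≈ w (remove z π ⟨$⟩ʳ j)
    x*w≈w∘π j = begin
      x * element (punchIn z j)                              ≈⟨ strictlyInverseˡ _ ⟨
      element (π ⟨$⟩ʳ punchIn z j)                            ≡⟨ ≡.cong element (punchIn-permute π z j) ⟩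
      element (punchIn (π ⟨$⟩ʳ z) (remove z π ⟨$⟩ʳ j))        ≡⟨ ≡.cong (λ i → element (punchIn i (remove z π ⟨$⟩ʳ j))) π-fixes-z ⟩
      element (punchIn z (remove z π ⟨$⟩ʳ j))                ∎
    xᵐ≈1 : x ^ m ≈ 1#
    xᵐ≈1 = *-cancelˡ (product-nonzero w w≉0) (begin
      product w * x ^ m   ≈⟨ *-comm _ _ ⟩
      x ^ m * product w   ≈⟨ sum-translate *-commutativeMonoid w (remove z π) x x*w≈w∘π ⟩
      product w           ≈⟨ *-identityʳ _ ⟨
      product w * 1#      ∎)

-- Cycles of f

module _ {a ℓ} (F : CommutativeRing a ℓ) where
  open CommutativeRing F

  record IsRingInvolution (Φ : Carrier → Carrier) : Set (a ⊔ ℓ) where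
    field
      cong       : ∀ {x y} → x ≈ y → Φ x ≈ Φ y
      +-homo     : ∀ x y → Φ (x + y) ≈ Φ x + Φ y
      *-homo     : ∀ x y → Φ (x * y) ≈ Φ x * Φ y
      involutive : ∀ x → Φ (Φ x) ≈ x

    open import Algebra.Properties.Ring ring using (x+x≈x⇒x≈0)
    open import Algebra.Properties.Group +-group using (inverseˡ-unique)

    0-homo : Φ 0# ≈ 0#
    0-homo = x+x≈x⇒x≈0 (Φ 0#) (trans (sym (+-homo 0# 0#)) (cong (+-identityʳ 0#)))

    -‿homo : ∀ x → Φ (- x) ≈ - Φ x
    -‿homo x = inverseˡ-unique (Φ (- x)) (Φ x) (trans (sym (+-homo (- x) x)) (trans (cong (-‿inverseˡ x)) 0-homo))

    nonzero : ∀ {x} → ¬ x ≈ 0# → ¬ Φ x ≈ 0#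
    nonzero x≉0 Φx≈0 = x≉0 (trans (sym (involutive _)) (trans (cong Φx≈0) 0-homo))

module _ {a ℓ} (F : CommutativeRing a ℓ) (isField : IsField F) where
  open CommutativeRing F
  open FieldProperties F isField
  open import Algebra.Properties.Ring ring using (-‿distribˡ-*; -‿distribʳ-*; [y-z]x≈yx-zx)
  open import Algebra.Properties.AbelianGroup +-abelianGroup using (⁻¹-anti-homo‿-)
  open import Algebra.Properties.Group +-group using (⁻¹-involutive)
  open import Algebra.Solver.CommutativeMonoid *-commutativeMonoid using (solve; _⊕_; _⊜_)
  open import Relation.Binary.Reasoning.Setoid setoid

  module _ (2≉0 : ¬ 1# + 1# ≈ 0#) {Φ} (Φ-involution : IsRingInvolution F Φ) {c} (Φc≈c : Φ c ≈ c)
           {f : Carrier → Carrier} (f-def : ∀ x → f x ≈ c * (Φ x * x - x * x)) where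
    open IsRingInvolution Φ-involution renaming (cong to Φ-cong)

    scale : Carrier → Carrier
    scale x = c * (Φ x - x)

    f≈scale*id : ∀ x → f x ≈ scale x * x
    f≈scale*id x = begin
      f x                        ≈⟨ f-def x ⟩
      c * (Φ x * x - x * x)      ≈⟨ *-congˡ ([y-z]x≈yx-zx x (Φ x) x) ⟨
      c * ((Φ x - x) * x)        ≈⟨ *-assoc c (Φ x - x) x ⟨
      scale x * x                ∎

    f-cong : ∀ {x y} → x ≈ y → f x ≈ f y
    f-cong {x} {y} x≈y = begin
      f x              ≈⟨ f≈scale*id x ⟩
      scale x * x      ≈⟨ *-cong (*-congˡ (+-cong (Φ-cong x≈y) (-‿cong x≈y))) x≈y ⟩
      scale y * y      ≈⟨ f≈scale*id y ⟨
      f y              ∎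

    Φ∘scale : ∀ x → Φ (scale x) ≈ - scale x
    Φ∘scale x = begin
      Φ (c * (Φ x - x))          ≈⟨ *-homo c (Φ x - x) ⟩
      Φ c * Φ (Φ x - x)          ≈⟨ *-cong Φc≈c (+-homo (Φ x) (- x)) ⟩
      c * (Φ (Φ x) + Φ (- x))    ≈⟨ *-congˡ (+-cong (involutive x) (-‿homo x)) ⟩
      c * (x - Φ x)              ≈⟨ *-congˡ (⁻¹-anti-homo‿- (Φ x) x) ⟨
      c * - (Φ x - x)            ≈⟨ -‿distribʳ-* c (Φ x - x) ⟨
      - scale x                  ∎

    ratio-negated : ∀ x → (f x , Φ (f x)) ∼ (- x , Φ x)
    ratio-negated x = begin
      f x * Φ x                        ≈⟨ *-congʳ (f≈scale*id x) ⟩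
      (s * x) * Φ x                    ≈⟨ solve 3 (λ s x u → (s ⊕ x) ⊕ u ⊜ x ⊕ (s ⊕ u)) refl s x (Φ x) ⟩
      x * (s * Φ x)                    ≈⟨ ⁻¹-involutive _ ⟨
      - - (x * (s * Φ x))              ≈⟨ -‿cong (-‿distribˡ-* x (s * Φ x)) ⟩
      - (- x * (s * Φ x))              ≈⟨ -‿distribʳ-* (- x) (s * Φ x) ⟩
      - x * - (s * Φ x)                ≈⟨ *-congˡ (-‿distribˡ-* s (Φ x)) ⟩
      - x * (- s * Φ x)                ≈⟨ *-congˡ (*-congʳ (Φ∘scale x)) ⟨
      - x * (Φ s * Φ x)                ≈⟨ *-congˡ (*-homo s x) ⟨
      - x * Φ (s * x)                  ≈⟨ *-congˡ (Φ-cong (f≈scale*id x)) ⟨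
      - x * Φ (f x)                    ∎
      where s = scale x

    ratio-orbit : ∀ α i → (∀ j → j < i → ¬ iter f j α ≈ 0#) →
                  (iter f i α , Φ (iter f i α)) ∼ (iter -_ i α , Φ α)
    ratio-orbit α zero    _     = refl
    ratio-orbit α (suc i) fʲα≉0 =
      ∼-trans (nonzero (fʲα≉0 i ℕ.≤-refl)) (ratio-negated (iter f i α))
        (∼-negate (ratio-orbit α i (λ j j<i → fʲα≉0 j (ℕ.m<n⇒m<1+n j<i))))

    f0≈0 : f 0# ≈ 0#
    f0≈0 = trans (f≈scale*id 0#) (zeroʳ _)

    cycles-even : ∀ α n → IsCycleLength F f α n → 1 < n → 2 ∣ n
    cycles-even α n cycle@(_ , fⁿα≈α , _) 1<n with even-or-odd n
    ... | inj₁ 2∣n = 2∣n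
    ... | inj₂ (m , ≡.refl) = contradiction αΦα≈0 (*-nonzero α≉0 (nonzero α≉0))
      where
      avoids-0 : ∀ {j} → j ≤ n → ¬ iter f j α ≈ 0#
      avoids-0 = cycle-avoids-fixed-point F f-cong cycle 1<n f0≈0
      α≉0 : ¬ α ≈ 0#
      α≉0 = avoids-0 z≤n
      αΦα≈-αΦα : α * Φ α ≈ - (α * Φ α)
      αΦα≈-αΦα = begin
        α * Φ α                          ≈⟨ *-congʳ fⁿα≈α ⟨
        iter f n α * Φ α                 ≈⟨ ratio-orbit α n (λ j j<n → avoids-0 (ℕ.<⇒≤ j<n)) ⟩
        iter -_ n α * Φ (iter f n α)     ≈⟨ *-cong (iter-odd F {g = -_} ⁻¹-involutive m α) (Φ-cong fⁿα≈α) ⟩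
        - α * Φ α                        ≈⟨ -‿distribˡ-* α (Φ α) ⟨
        - (α * Φ α)                      ∎
      αΦα≈0 : α * Φ α ≈ 0#
      αΦα≈0 = x+x≈0⇒x≈0 2≉0 (begin
        α * Φ α + α * Φ α        ≈⟨ +-congʳ αΦα≈-αΦα ⟩
        - (α * Φ α) + α * Φ α    ≈⟨ -‿inverseˡ _ ⟩
        0#                       ∎)

-- The field with q² elements

module _ {a ℓ} (F : CommutativeRing a ℓ) (isField : IsField F) {p} (p-prime : Prime p) k
         (card : HasCard F (p ℕ.^ k ℕ.* p ℕ.^ k)) where
  open CommutativeRing F
  open IsField isField using (1≉0)
  open FiniteField F isField card using (card×x≈0; ^≈0⇒≈0)
  open import Algebra.Properties.Semiring.Mult semiring using (_×_)
  open import Algebra.Properties.CommutativeSemiring.Exp commutativeSemiring using (_^_; ^-congˡ; ^-assocʳ; ^-distrib-*)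
  open import Relation.Binary.Reasoning.Setoid setoid

  characteristic : p × 1# ≈ 0#
  characteristic = ^≈0⇒≈0 (k ℕ.+ k) (begin
    (p × 1#) ^ (k ℕ.+ k)          ≈⟨ ×1-homo-^ commutativeSemiring p (k ℕ.+ k) ⟨
    (p ℕ.^ (k ℕ.+ k)) × 1#        ≡⟨ ≡.cong (_× 1#) (ℕ.^-distribˡ-+-* p k k) ⟩
    (p ℕ.^ k ℕ.* p ℕ.^ k) × 1#    ≈⟨ card×x≈0 1# ⟩
    0#                            ∎)

  odd-characteristic : ¬ p ≡ 2 → ¬ 1# + 1# ≈ 0#
  odd-characteristic p≢2 1+1≈0 with prime≢2⇒odd p-prime p≢2
  ... | m , ≡.refl = 1≉0 (trans (sym (odd×1≈1 commutativeSemiring 1+1≈0 m)) characteristic)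

  frobenius-involution : IsRingInvolution F (_^ (p ℕ.^ k))
  frobenius-involution = record
    { cong       = ^-congˡ q
    ; +-homo     = frobenius-^ commutativeSemiring p-prime characteristic k
    ; *-homo     = λ x y → ^-distrib-* x y q
    ; involutive = λ x → trans (^-assocʳ x q q) (x^card≈x F isField card x)
    }
    where
    q : ℕ
    q = p ℕ.^ k

lemma2p8 : ∀ {a ℓ} (F : CommutativeRing a ℓ) → IsField F →
    ∀ (q : ℕ) → OddPrimePower q → HasCard F (q ℕ.* q) →
    let open CommutativeRing F in
    ∀ (c : Carrier) → pow F c q ≈ c → ¬ (c ≈ 0#) →
    ∀ (α : Carrier) (n : ℕ) →
    IsCycleLength F (λ x → c * (pow F x (q ℕ.+ 1) - pow F x 2)) α n →
    1 < n → 2 ∣ n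
lemma2p8 F isField _ (p , k , p-prime , p≢2 , _ , ≡.refl) card c cᵠ≈c _ =
  cycles-even F isField (odd-characteristic F isField p-prime k card p≢2)
    (frobenius-involution F isField p-prime k card) (≡.subst (_≈ c) (pow≡^ c q) cᵠ≈c) f-def
  where
  open CommutativeRing F
  open import Algebra.Properties.CommutativeSemiring.Exp commutativeSemiring using (_^_; ^-homo-*)
  q : ℕ
  q = p ℕ.^ k
  pow≡^ : ∀ x n → pow F x n ≡ x ^ n
  pow≡^ x zero    = ≡.refl
  pow≡^ x (suc n) = ≡.cong (x *_) (pow≡^ x n)
  f-def : ∀ x → c * (pow F x (q ℕ.+ 1) - pow F x 2) ≈ c * (x ^ q * x - x * x)
  f-def x = *-congˡ (+-cong xᵠ⁺¹≈xᵠx (-‿cong (*-congˡ (*-identityʳ x))))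
    where
    xᵠ⁺¹≈xᵠx : pow F x (q ℕ.+ 1) ≈ x ^ q * x
    xᵠ⁺¹≈xᵠx = trans (reflexive (pow≡^ x (q ℕ.+ 1))) (trans (^-homo-* x q 1) (*-congˡ (*-identityʳ x)))
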